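{- For every graph $G$, $\operatorname{tw}(G)\leq \operatorname{ecw}(G)$.
   Context: Graphs are finite and undirected. $\operatorname{tw}(G)$ denotes the treewidth of $G$. Edge-cut width: for a graph $G$ and a maximal spanning forest $T$ of $G$, the local feedback edge set at $v\in V(G)$ is $E_{\mathrm{loc}}^{G,T}(v)=\{uw\in E(G)\setminus E(T) : \text{the unique path between } u \text{ and } w \text{ in } T \text{ contains } v\}$. The edge-cut width of $(G,T)$ is $\operatorname{ecw}(G,T)=1+\max_{v\in V(G)}|E_{\mathrm{loc}}^{G,T}(v)|$, and $\operatorname{ecw}(G)$ is the minimum of $\operatorname{ecw}(G,T)$ over all maximal spanning forests $T$ of $G$. -}

module Defs where

open import Data.Nat using (ℕ; zero; suc; _≤_; _<_)
open import Data.Bool using (Bool; true; false)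
open import Data.Fin using (Fin; toℕ)
open import Data.Fin.Subset using (Subset; _∈_; ∣_∣)
open import Data.List using (List; []; _∷_; length)
open import Data.List.Relation.Unary.All using (All)
open import Data.List.Relation.Unary.Unique.Propositional using (Unique)
import Data.List.Membership.Propositional as LM
open import Data.Product using (Σ; ∃; _×_)
open import Relation.Nullary using (¬_)
open import Relation.Binary.PropositionalEquality using (_≡_)

record SimpleGraph (n : ℕ) : Set where
  field
    adj    : Fin n → Fin n → Bool
    sym    : ∀ u v → adj u v ≡ adj v u
    irrefl : ∀ v → adj v v ≡ false
open SimpleGraph public

Edge : ∀ {n} → SimpleGraph n → Fin n → Fin n → Set
Edge H u v = adj H u v ≡ true

data Walk {n} (H : SimpleGraph n) : Fin n → Fin n → List (Fin n) → Set where
  here : ∀ {u} → Walk H u u (u ∷ [])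
  step : ∀ {u v w vs} → Edge H u v → Walk H v w vs → Walk H u w (u ∷ vs)

Path : ∀ {n} → SimpleGraph n → Fin n → Fin n → List (Fin n) → Set
Path H u w vs = Walk H u w vs × Unique vs

HasCycle : ∀ {n} → SimpleGraph n → Set
HasCycle H = Σ _ λ u → Σ _ λ w → Σ _ λ vs →
  Path H u w vs × 3 ≤ length vs × Edge H w u

IsForest : ∀ {n} → SimpleGraph n → Set
IsForest H = ¬ HasCycle H

Connected : ∀ {n} → SimpleGraph n → Set
Connected H = ∀ u w → ∃ λ vs → Walk H u w vs

IsTree : ∀ {n} → SimpleGraph n → Set
IsTree {n} H = 1 ≤ n × Connected H × IsForest H

-- T is a maximal spanning forest of G: a spanning subgraph of G which is a
-- forest and in which the endpoints of every edge of G are connected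
-- (so each component of G is spanned by a tree of T).
IsMaxSpanningForest : ∀ {n} → SimpleGraph n → SimpleGraph n → Set
IsMaxSpanningForest G T =
  (∀ u v → Edge T u v → Edge G u v) × IsForest T
  × (∀ u w → Edge G u w → ∃ λ vs → Walk T u w vs)

-- v lies on the (unique, as T is a forest) path between u and w in T.
OnTreePath : ∀ {n} → SimpleGraph n → Fin n → Fin n → Fin n → Set
OnTreePath T u w v = ∃ λ vs → Path T u w vs × LM._∈_ v vs

-- The edge {u,w} (encoded as the pair (u,w) with u < w) belongs to
-- the local feedback edge set E_loc^{G,T}(v).
InLocalFeedback : ∀ {n} → SimpleGraph n → SimpleGraph n → Fin n → Fin n × Fin n → Set
InLocalFeedback G T v (u Data.Product., w) =
  toℕ u < toℕ w × Edge G u w × ¬ Edge T u w × OnTreePath T u w v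

-- |E_loc^{G,T}(v)| ≤ k : every duplicate-free list of its elements has length ≤ k.
LocalFeedbackAtMost : ∀ {n} → SimpleGraph n → SimpleGraph n → Fin n → ℕ → Set
LocalFeedbackAtMost {n} G T v k =
  (es : List (Fin n × Fin n)) → Unique es → All (InLocalFeedback G T v) es → length es ≤ k

-- ecw(G,T) ≤ suc k  (ecw(G,T) = 1 + max_v |E_loc(v)|)
EcwAtMostSuc : ∀ {n} → SimpleGraph n → SimpleGraph n → ℕ → Set
EcwAtMostSuc G T k = ∀ v → LocalFeedbackAtMost G T v k

record TreeDecomposition {n} (G : SimpleGraph n) : Set where
  field
    m         : ℕ
    tree      : SimpleGraph m
    isTree    : IsTree tree
    bag       : Fin m → Subset n
    covers    : ∀ v → ∃ λ t → v ∈ bag t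
    edgeCover : ∀ u v → Edge G u v → ∃ λ t → (u ∈ bag t × v ∈ bag t)
    coherent  : ∀ v t₁ t₂ → v ∈ bag t₁ → v ∈ bag t₂ →
                ∃ λ ts → Walk tree t₁ t₂ ts × All (λ t → v ∈ bag t) ts
open TreeDecomposition public

-- width(D) ≤ w  (width = max bag size − 1)
WidthAtMost : ∀ {n} {G : SimpleGraph n} → TreeDecomposition G → ℕ → Set
WidthAtMost D w = ∀ t → ∣ bag D t ∣ ≤ suc w

TreewidthAtMost : ∀ {n} → SimpleGraph n → ℕ → Set
TreewidthAtMost G w = Σ (TreeDecomposition G) λ D → WidthAtMost D w

{-# OPTIONS --safe #-}
-- Extend the forest T to a spanning tree D by attaching leaves one at a time, and orient D
-- so that every T-edge joins a vertex v to its parent p(v). D is the decomposition tree, with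
-- bag(v) = {v, p(v)} ∪ {u : uw ∈ E_loc(v), u < w}; hence |bag(v)| ≤ 2 + |E_loc(v)| ≤ ecw + 1.
-- A T-edge v p(v) lies in bag(v), and a non-tree edge uw with u < w lies in bag(w), since w is
-- on the T-path from u to w. The bags containing u are connected in D: u ∈ bag(t) means t = u,
-- u = p(t), or t lies on the T-path from u to some w, and then so does every vertex of the
-- T-path from u to t.
module Submission where

open import Defs
open import Data.Bool using (Bool; true; false; _∧_; _∨_)
open import Data.Bool.Properties using (∧-comm; ∨-comm; ∨-zeroʳ; T-≡)
import Data.Bool.Properties as Bool
open import Data.Empty using (⊥; ⊥-elim)
open import Data.Fin using (Fin; zero; suc; toℕ; _≟_)
import Data.Fin.Properties as Fin
open import Data.Fin.Subset using (Subset; inside; outside; ∣_∣)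
import Data.Fin.Subset as S
open import Data.List using (List; []; _∷_; length; filter; map; allFin)
open import Data.List.Properties using (filter-notAll; length-tabulate; length-map)
open import Data.List.Membership.Propositional using (_∈_; _∉_; find)
open import Data.List.Membership.Propositional.Properties
  using (∈-filter⁺; ∈-filter⁻; ∈-allFin; ∈-map⁺; ∈-map⁻)
open import Data.List.Relation.Binary.Subset.Propositional using (_⊆_)
open import Data.List.Relation.Unary.All using (All; []; _∷_)
import Data.List.Relation.Unary.All as All
open import Data.List.Relation.Unary.All.Properties using (¬Any⇒All¬)
open import Data.List.Relation.Unary.AllPairs using ([]; _∷_)
open import Data.List.Relation.Unary.Any using (here; there; any?)
import Data.List.Relation.Unary.Any as Any
open import Data.List.Relation.Unary.Unique.Propositional using (Unique)
open import Data.List.Relation.Unary.Unique.Propositional.Properties using (filter⁺; map⁺; allFin⁺)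
import Data.List.Relation.Unary.Unique.DecPropositional as Unique
open import Data.Nat using (ℕ; zero; suc; _+_; _≤_; _<_; z≤n; s≤s)
open import Data.Nat.Properties
  using (≤-refl; ≤-trans; ≤-pred; ≤-reflexive; +-suc; +-identityʳ; <-irrefl; n≤1+n)
open import Data.Product using (∃; _×_; _,_; proj₁; proj₂)
open import Data.Sum using (_⊎_; inj₁; inj₂; [_,_])
import Data.Sum as Sum
open import Data.Vec using ([]; _∷_)
import Data.Vec as Vec
open import Data.Vec.Properties using (lookup∘tabulate; lookup⇒[]=; []=⇒lookup)
open import Function using (_∘_; id)
open import Function.Bundles using (Equivalence)
open import Relation.Binary using (tri<; tri≈; tri>)
open import Relation.Binary.PropositionalEquality as ≡ using (_≡_; _≢_; refl; subst; cong; cong₂)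
open import Relation.Nullary using (¬_; Dec; yes; no; ¬?)
open import Relation.Nullary.Decidable using (⌊_⌋; _×-dec_; _⊎-dec_; toWitness; fromWitness)

private variable
  n : ℕ
  H H′ T : SimpleGraph n
  u v w x y : Fin n
  vs ws : List (Fin n)

Unique-∷ : x ∉ vs → Unique vs → Unique (x ∷ vs)
Unique-∷ {vs = vs} x∉vs uniq = ¬Any⇒All¬ vs x∉vs ∷ uniq

Unique-⊆⇒length≤ : Unique vs → vs ⊆ ws → length vs ≤ length ws
Unique-⊆⇒length≤ {vs = []} _ _ = z≤n
Unique-⊆⇒length≤ {vs = x ∷ vs} {ws} (x≢vs ∷ uniq) x∷vs⊆ws =
  ≤-trans (s≤s (Unique-⊆⇒length≤ uniq vs⊆ws-x))
          (filter-notAll (λ z → ¬? (x ≟ z)) ws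
                         (Any.map (λ x≡z x≢z → x≢z x≡z) (x∷vs⊆ws (here refl))))
  where
  vs⊆ws-x : vs ⊆ filter (λ z → ¬? (x ≟ z)) ws
  vs⊆ws-x z∈vs = ∈-filter⁺ (λ z → ¬? (x ≟ z)) (x∷vs⊆ws (there z∈vs)) (All.lookup x≢vs z∈vs)

_∈?_ : (x : Fin n) (vs : List (Fin n)) → Dec (x ∈ vs)
x ∈? vs = any? (x ≟_) vs

Unique⇒length≤n : {vs : List (Fin n)} → Unique vs → length vs ≤ n
Unique⇒length≤n {n} uniq =
  ≤-trans (Unique-⊆⇒length≤ uniq (λ {z} _ → ∈-allFin z)) (≤-reflexive (length-tabulate id))

_∖_ : List (Fin n) → Fin n → List (Fin n)
As ∖ ℓ = filter (λ z → ¬? (z ≟ ℓ)) As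

∈-∖⁺ : x ∈ vs → x ≢ y → x ∈ vs ∖ y
∈-∖⁺ {y = y} = ∈-filter⁺ (λ z → ¬? (z ≟ y))

∈-∖⁻ : ∀ vs → x ∈ vs ∖ y → x ∈ vs × x ≢ y
∈-∖⁻ {y = y} vs = ∈-filter⁻ (λ z → ¬? (z ≟ y)) {xs = vs}

Unique-∖ : Unique vs → Unique (vs ∖ x)
Unique-∖ {x = x} = filter⁺ (λ z → ¬? (z ≟ x))

length-∖ : x ∈ vs → length (vs ∖ x) < length vs
length-∖ {x = x} {vs} x∈ =
  filter-notAll (λ z → ¬? (z ≟ x)) vs (Any.map (λ { refl x≢x → x≢x refl }) x∈)

-- Graphs, walks and paths

Edge-sym : (H : SimpleGraph n) → Edge H u v → Edge H v u
Edge-sym {u = u} {v = v} H e = ≡.trans (SimpleGraph.sym H v u) e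

Edge-irrefl : (H : SimpleGraph n) → ¬ Edge H v v
Edge-irrefl {v = v} H e with ≡.trans (≡.sym e) (irrefl H v)
... | ()

edge? : (H : SimpleGraph n) → ∀ u v → Dec (Edge H u v)
edge? H u v = adj H u v Bool.≟ true

emptyGraph : ∀ n → SimpleGraph n
emptyGraph n = record { adj = λ _ _ → false ; sym = λ _ _ → refl ; irrefl = λ _ → refl }

walk-head∈ : Walk H u w vs → u ∈ vs
walk-head∈ here       = here refl
walk-head∈ (step _ _) = here refl

walk-last∈ : Walk H u w vs → w ∈ vs
walk-last∈ here       = here refl
walk-last∈ (step _ p) = there (walk-last∈ p)

walk-length-pos : Walk H u w vs → 0 < length vs
walk-length-pos here       = s≤s z≤n
walk-length-pos (step _ _) = s≤s z≤n

walk-map : (∀ {x y} → x ∈ vs → y ∈ vs → Edge H x y → Edge H′ x y) →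
           Walk H u w vs → Walk H′ u w vs
walk-map f here       = here
walk-map f (step e p) =
  step (f (here refl) (there (walk-head∈ p)) e) (walk-map (λ x∈ y∈ → f (there x∈) (there y∈)) p)

walk-++ : Walk H u v vs → Walk H v w ws →
          ∃ λ zs → Walk H u w zs × (∀ {z} → z ∈ zs → z ∈ vs ⊎ z ∈ ws)
walk-++ here       q = _ , q , inj₂
walk-++ (step e p) q with walk-++ p q
... | zs , r , zs⊆ = _ , step e r , λ { (here refl) → inj₁ (here refl)
                                      ; (there z∈) → Sum.map₁ there (zs⊆ z∈) }

walk-reverse : Walk H u w vs → ∃ λ zs → Walk H w u zs × zs ⊆ vs
walk-reverse here = _ , here , id
walk-reverse {H = H} (step e p) with walk-reverse p
... | zs , r , zs⊆ with walk-++ r (step (Edge-sym H e) here)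
...   | ys , q , ys⊆ = ys , q , λ y∈ → [ there ∘ zs⊆ , back ] (ys⊆ y∈)
  where
  back : ∀ {z} → z ∈ _ ∷ _ ∷ [] → z ∈ _
  back (here refl)         = there (walk-head∈ p)
  back (there (here refl)) = here refl

walk-head≡ : Walk H u w (v ∷ vs) → u ≡ v
walk-head≡ here       = refl
walk-head≡ (step _ _) = refl

walk-last-edge : Walk H u w vs → 2 ≤ length vs → ∃ λ x → x ∈ vs × Edge H x w
walk-last-edge here                          (s≤s ())
walk-last-edge (step e here)                 _ = _ , here refl , e
walk-last-edge (step _ (step e here))        _ = _ , there (here refl) , e
walk-last-edge (step _ p@(step _ (step _ _))) _ with walk-last-edge p (s≤s (s≤s z≤n))
... | x , x∈ , e = x , there x∈ , e

path-prefix : Path H u w vs → y ∈ vs → ∃ λ pre → Path H u y pre × pre ⊆ vs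
path-prefix (here , uniq)   (here refl) = _ , (here , uniq) , id
path-prefix (step _ _ , _)  (here refl) = _ , (here , [] ∷ []) , λ { (here refl) → here refl }
path-prefix (step e p , u≢vs ∷ uniq) (there y∈vs) with path-prefix (p , uniq) y∈vs
... | pre , (q , uniq′) , pre⊆vs =
  _ , (step e q , Unique-∷ (λ u∈pre → All.lookup u≢vs (pre⊆vs u∈pre) refl) uniq′) ,
  λ { (here refl) → here refl ; (there z∈pre) → there (pre⊆vs z∈pre) }

path-suffix : Path H u w vs → y ∈ vs → ∃ λ suf → Path H y w suf × suf ⊆ vs
path-suffix (here , uniq)        (here refl)  = _ , (here , uniq) , id
path-suffix (step e p , uniq)    (here refl)  = _ , (step e p , uniq) , id
path-suffix (step _ p , _ ∷ uniq) (there y∈vs) with path-suffix (p , uniq) y∈vs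
... | suf , path , suf⊆vs = suf , path , there ∘ suf⊆vs

walk⇒path : Walk H u w vs → ∃ λ ps → Path H u w ps × ps ⊆ vs
walk⇒path here = _ , (here , [] ∷ []) , id
walk⇒path {u = u} (step e p) with walk⇒path p
... | ps , (q , uniq) , ps⊆vs with u ∈? ps
...   | yes u∈ps with path-suffix (q , uniq) u∈ps
...     | suf , path , suf⊆ps = suf , path , there ∘ ps⊆vs ∘ suf⊆ps
walk⇒path {u = u} (step e p) | ps , (q , uniq) , ps⊆vs | no u∉ps =
  _ , (step e q , Unique-∷ u∉ps uniq) ,
  λ { (here refl) → here refl ; (there z∈ps) → there (ps⊆vs z∈ps) }

-- Pendant vertices and leaves of forests

Pendant : SimpleGraph n → Fin n → Fin n → Set
Pendant H ℓ a = ∀ y → Edge H ℓ y → y ≡ a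

module _ {H : SimpleGraph n} {ℓ a : Fin n} (pendant : Pendant H ℓ a) where

  pendant-not-interior : Path H u w vs → ℓ ∈ vs → ℓ ≢ u → ℓ ≢ w → ⊥
  pendant-not-interior (here , _)     (here refl) ℓ≢u _ = ℓ≢u refl
  pendant-not-interior (step _ _ , _) (here refl) ℓ≢u _ = ℓ≢u refl
  pendant-not-interior (step {v = v} e p , u≢vs ∷ uniq) (there ℓ∈) ℓ≢u ℓ≢w with ℓ ≟ v
  ... | no ℓ≢v = pendant-not-interior (p , uniq) ℓ∈ ℓ≢v ℓ≢w
  pendant-not-interior (step e here , _) (there ℓ∈) ℓ≢u ℓ≢w | yes refl = ℓ≢w refl
  pendant-not-interior (step e (step e′ p) , u≢vs ∷ uniq) (there ℓ∈) ℓ≢u ℓ≢w | yes refl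
    with pendant _ (Edge-sym H e) | pendant _ e′
  ... | refl | refl = All.lookup u≢vs (there (walk-head∈ p)) refl

  -- On a cycle ℓ has two distinct neighbours, and both would have to be a.
  pendant-not-on-cycle : Path H u w vs → 3 ≤ length vs → Edge H w u → ℓ ∉ vs
  pendant-not-on-cycle {u} {w} path len ewu ℓ∈ with ℓ ≟ u | ℓ ≟ w
  pendant-not-on-cycle (here , _)          (s≤s ())           _ _ | yes refl | _
  pendant-not-on-cycle (step _ here , _)   (s≤s (s≤s ()))     _ _ | yes refl | _
  pendant-not-on-cycle (step e (step e′ p) , _ ∷ (v≢vs ∷ _)) _ ewu _ | yes refl | _
    with pendant _ e | pendant _ (Edge-sym H ewu)
  ... | refl | refl = All.lookup v≢vs (walk-last∈ p) refl
  pendant-not-on-cycle {u} (step e p , u≢vs ∷ _) (s≤s len) ewu _ | no _ | yes refl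
    with walk-last-edge p len
  ... | x , x∈ , exℓ with pendant _ (Edge-sym H exℓ) | pendant u ewu
  ...   | refl | refl = All.lookup u≢vs x∈ refl
  pendant-not-on-cycle path _ _ ℓ∈ | no ℓ≢u | no ℓ≢w = pendant-not-interior path ℓ∈ ℓ≢u ℓ≢w

module _ (H : SimpleGraph n) {a b : Fin n} (a≢b : a ≢ b) where

  private
    is : Fin n → Fin n → Bool
    is u v = ⌊ u ≟ v ⌋

    joins : Fin n → Fin n → Bool
    joins u v = is u a ∧ is v b ∨ is u b ∧ is v a

  addEdge : SimpleGraph n
  addEdge = record
    { adj    = λ u v → joins u v ∨ adj H u v
    ; sym    = λ u v → cong₂ _∨_ (joins-sym u v) (SimpleGraph.sym H u v)
    ; irrefl = joins-irrefl
    }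
    where
    joins-sym : ∀ u v → joins u v ≡ joins v u
    joins-sym u v = ≡.trans (cong₂ _∨_ (∧-comm (is u a) (is v b)) (∧-comm (is u b) (is v a)))
                            (∨-comm (is v b ∧ is u a) (is v a ∧ is u b))
    joins-irrefl : ∀ v → joins v v ∨ adj H v v ≡ false
    joins-irrefl v with v ≟ a | v ≟ b
    ... | yes refl | yes refl = ⊥-elim (a≢b refl)
    ... | yes _    | no _     = irrefl H v
    ... | no _     | yes _    = irrefl H v
    ... | no _     | no _     = irrefl H v

  addEdge-⊇ : Edge H u v → Edge addEdge u v
  addEdge-⊇ {u} {v} e = ≡.trans (cong (joins u v ∨_) e) (∨-zeroʳ (joins u v))

  addEdge-new : Edge addEdge a b
  addEdge-new with a ≟ a | b ≟ b
  ... | yes _ | yes _ = refl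
  ... | no a≢a | _ = ⊥-elim (a≢a refl)
  ... | _ | no b≢b = ⊥-elim (b≢b refl)

  addEdge-edge⁻ : Edge addEdge u v → Edge H u v ⊎ (u ≡ a × v ≡ b) ⊎ (u ≡ b × v ≡ a)
  addEdge-edge⁻ {u} {v} e with u ≟ a | v ≟ b | u ≟ b | v ≟ a
  ... | yes u≡a | yes v≡b | _       | _       = inj₂ (inj₁ (u≡a , v≡b))
  ... | _       | _       | yes u≡b | yes v≡a = inj₂ (inj₂ (u≡b , v≡a))
  ... | no _    | _       | no _    | _       = inj₁ e
  ... | no _    | _       | yes _   | no _    = inj₁ e
  ... | yes _   | no _    | no _    | _       = inj₁ e
  ... | yes _   | no _    | yes _   | no _    = inj₁ e

module _ {H : SimpleGraph n} {ℓ a : Fin n} (ℓ≢a : ℓ ≢ a) (isolated : ∀ y → ¬ Edge H ℓ y) where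

  addEdge-pendant : Pendant (addEdge H ℓ≢a) ℓ a
  addEdge-pendant y e with addEdge-edge⁻ H ℓ≢a e
  ... | inj₁ e′               = ⊥-elim (isolated y e′)
  ... | inj₂ (inj₁ (_ , y≡a)) = y≡a
  ... | inj₂ (inj₂ (ℓ≡a , _)) = ⊥-elim (ℓ≢a ℓ≡a)

  addEdge-pendant-forest : IsForest H → IsForest (addEdge H ℓ≢a)
  addEdge-pendant-forest forest (u , w , vs , (p , uniq) , len , ewu) with ℓ ∈? vs
  ... | yes ℓ∈vs = pendant-not-on-cycle addEdge-pendant (p , uniq) len ewu ℓ∈vs
  ... | no ℓ∉vs  =
    forest (u , w , vs , (walk-map old p , uniq) , len , old (walk-last∈ p) (walk-head∈ p) ewu)
    where
    old : ∀ {x y} → x ∈ vs → y ∈ vs → Edge (addEdge H ℓ≢a) x y → Edge H x y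
    old x∈ y∈ e with addEdge-edge⁻ H ℓ≢a e
    ... | inj₁ e′                 = e′
    ... | inj₂ (inj₁ (refl , _))  = ⊥-elim (ℓ∉vs x∈)
    ... | inj₂ (inj₂ (_ , refl))  = ⊥-elim (ℓ∉vs y∈)

forest-neighbour-on-path : IsForest H → Edge H u v → Walk H v w vs → Unique (u ∷ vs) →
                           Edge H u x → x ∈ u ∷ vs → x ≡ v
forest-neighbour-on-path {H = H} _ _ _ _ eux (here refl) = ⊥-elim (Edge-irrefl H eux)
forest-neighbour-on-path _ _ here _ _ (there (here refl)) = refl
forest-neighbour-on-path _ _ (step _ _) _ _ (there (here refl)) = refl
forest-neighbour-on-path {H = H} forest e (step e′ p) (u≢ ∷ v≢ ∷ uniq) eux (there (there x∈))
  with path-prefix (p , uniq) x∈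
... | pre , (q , uniq′) , pre⊆ =
  ⊥-elim (forest (_ , _ , _ , (step e (step e′ q) , uniq-cycle) ,
                  s≤s (s≤s (walk-length-pos q)) , Edge-sym H eux))
  where
  uniq-cycle : Unique (_ ∷ _ ∷ pre)
  uniq-cycle = Unique-∷ (λ { (here u≡v) → All.lookup u≢ (here refl) u≡v
                           ; (there u∈) → All.lookup u≢ (there (pre⊆ u∈)) refl })
                        (Unique-∷ (λ v∈ → All.lookup v≢ (pre⊆ v∈) refl) uniq′)

record LeafIn (T : SimpleGraph n) (As : List (Fin n)) : Set where
  field
    leaf neighbour : Fin n
    leaf∈          : leaf ∈ As
    neighbour∈     : neighbour ∈ As
    neighbour≢leaf : neighbour ≢ leaf
    pendant        : ∀ z → z ∈ As → Edge T leaf z → z ≡ neighbour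

module _ {T : SimpleGraph n} (forest : IsForest T) {As : List (Fin n)} {x y : Fin n}
         (x∈ : x ∈ As) (y∈ : y ∈ As) (x≢y : x ≢ y) where

  private
    maximal-path-leaf : ∀ {ℓ vs} → Path T ℓ x vs → vs ⊆ As →
                        (∀ z → z ∈ As → Edge T ℓ z → z ∈ vs) → LeafIn T As
    maximal-path-leaf (here , _) _ stuck = record
      { leaf = x ; neighbour = y ; leaf∈ = x∈ ; neighbour∈ = y∈
      ; neighbour≢leaf = x≢y ∘ ≡.sym
      ; pendant = λ z z∈ exz → ⊥-elim (Edge-irrefl T (subst (Edge T x) (single (stuck z z∈ exz)) exz))
      }
      where
      single : ∀ {z} → z ∈ x ∷ [] → z ≡ x
      single (here z≡x) = z≡x
    maximal-path-leaf (step e p , uniq@(ℓ≢ ∷ _)) vs⊆ stuck = record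
      { leaf = _ ; neighbour = _ ; leaf∈ = vs⊆ (here refl) ; neighbour∈ = vs⊆ (there (walk-head∈ p))
      ; neighbour≢leaf = All.lookup ℓ≢ (walk-head∈ p) ∘ ≡.sym
      ; pendant = λ z z∈ eℓz → forest-neighbour-on-path forest e p uniq eℓz (stuck z z∈ eℓz)
      }

    grow-path : ∀ {ℓ vs} (fuel : ℕ) → Path T ℓ x vs → vs ⊆ As → length As ≤ length vs + fuel →
                LeafIn T As
    grow-path {ℓ} {vs} fuel path vs⊆ bound with any? (λ z → edge? T ℓ z ×-dec ¬? (z ∈? vs)) As
    ... | no ¬extendable = maximal-path-leaf path vs⊆ stuck
      where
      stuck : ∀ z → z ∈ As → Edge T ℓ z → z ∈ vs
      stuck z z∈ eℓz with z ∈? vs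
      ... | yes z∈vs = z∈vs
      ... | no z∉vs  = ⊥-elim (¬extendable (Any.map (λ { refl → eℓz , z∉vs }) z∈))
    ... | yes extendable with find extendable
    ...   | z , z∈ , eℓz , z∉vs = extend fuel bound
      where
      longer : Path T z x (z ∷ vs)
      longer = step (Edge-sym T eℓz) (proj₁ path) , Unique-∷ z∉vs (proj₂ path)

      z∷vs⊆ : z ∷ vs ⊆ As
      z∷vs⊆ (here refl) = z∈
      z∷vs⊆ (there w∈)  = vs⊆ w∈

      extend : ∀ fuel → length As ≤ length vs + fuel → LeafIn T As
      extend zero bound =
        ⊥-elim (<-irrefl refl (≤-trans (Unique-⊆⇒length≤ (proj₂ longer) z∷vs⊆)
                                       (≤-trans bound (≤-reflexive (+-identityʳ _)))))
      extend (suc fuel) bound =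
        grow-path fuel longer z∷vs⊆ (≤-trans bound (≤-reflexive (+-suc (length vs) fuel)))

  leafIn : LeafIn T As
  leafIn = grow-path (length As) (here , [] ∷ []) (λ { (here refl) → x∈ }) (n≤1+n (length As))

-- Oriented spanning trees

record OrientedSpanningTree (T : SimpleGraph n) (As : List (Fin n)) : Set where
  field
    graph       : SimpleGraph n
    parent      : Fin n → Fin n
    within      : ∀ {x y} → Edge graph x y → x ∈ As
    connected   : ∀ {x y} → x ∈ As → y ∈ As → ∃ λ vs → Walk graph x y vs
    acyclic     : IsForest graph
    extends     : ∀ {x y} → x ∈ As → y ∈ As → Edge T x y → Edge graph x y
    orients     : ∀ {x y} → x ∈ As → y ∈ As → Edge T x y → parent x ≡ y ⊎ parent y ≡ x
    parent-edge : ∀ t → parent t ≡ t ⊎ Edge graph t (parent t)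

singletonSpanningTree : (T : SimpleGraph n) (x : Fin n) → OrientedSpanningTree T (x ∷ [])
singletonSpanningTree {n} T x = record
  { graph       = emptyGraph n
  ; parent      = id
  ; within      = λ ()
  ; connected   = λ { (here refl) (here refl) → _ , here }
  ; acyclic     = λ { (_ , _ , _ , _ , _ , ()) }
  ; extends     = λ { (here refl) (here refl) e → ⊥-elim (Edge-irrefl T e) }
  ; orients     = λ { (here refl) (here refl) e → ⊥-elim (Edge-irrefl T e) }
  ; parent-edge = λ _ → inj₁ refl
  }

module _ {T : SimpleGraph n} {As : List (Fin n)} (L : LeafIn T As) where
  open LeafIn L renaming (leaf to ℓ; neighbour to a)

  attachLeaf : OrientedSpanningTree T (As ∖ ℓ) → OrientedSpanningTree T As
  attachLeaf S = record
    { graph       = D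
    ; parent      = parent
    ; within      = within
    ; connected   = connected
    ; acyclic     = addEdge-pendant-forest ℓ≢a (λ y e → proj₂ (∈-∖⁻ As (within′ e)) refl) acyclic′
    ; extends     = extends
    ; orients     = orients
    ; parent-edge = parent-edge
    }
    where
    open OrientedSpanningTree S renaming
      ( graph to D′; parent to parent′; within to within′; connected to connected′
      ; acyclic to acyclic′; extends to extends′; orients to orients′; parent-edge to parent-edge′)

    ℓ≢a : ℓ ≢ a
    ℓ≢a = neighbour≢leaf ∘ ≡.sym

    rest : ∀ {x} → x ∈ As → ℓ ≢ x → x ∈ As ∖ ℓ
    rest x∈ ℓ≢x = ∈-∖⁺ x∈ (ℓ≢x ∘ ≡.sym)

    a∈′ : a ∈ As ∖ ℓ
    a∈′ = rest neighbour∈ ℓ≢a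

    D : SimpleGraph n
    D = addEdge D′ ℓ≢a

    ℓa : Edge D ℓ a
    ℓa = addEdge-new D′ ℓ≢a

    lift : ∀ {x y vs} → Walk D′ x y vs → Walk D x y vs
    lift = walk-map (λ _ _ → addEdge-⊇ D′ ℓ≢a)

    -- Cases are split on ℓ ≟ x rather than x ≟ ℓ: the latter occurs in the adjacency
    -- of D, so a with-abstraction over it would also rewrite the goal.
    parent : Fin n → Fin n
    parent t with ℓ ≟ t
    ... | yes _ = a
    ... | no _  = parent′ t

    within : ∀ {x y} → Edge D x y → x ∈ As
    within e with addEdge-edge⁻ D′ ℓ≢a e
    ... | inj₁ e′                 = proj₁ (∈-∖⁻ As (within′ e′))
    ... | inj₂ (inj₁ (refl , _))  = leaf∈
    ... | inj₂ (inj₂ (refl , _))  = neighbour∈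

    to-a : ∀ {x} → x ∈ As → ∃ λ vs → Walk D x a vs
    to-a {x} x∈ with ℓ ≟ x
    ... | yes refl = _ , step ℓa here
    ... | no ℓ≢x   = _ , lift (proj₂ (connected′ (rest x∈ ℓ≢x) a∈′))

    connected : ∀ {x y} → x ∈ As → y ∈ As → ∃ λ vs → Walk D x y vs
    connected x∈ y∈ with walk-reverse (proj₂ (to-a y∈))
    ... | _ , a-to-y , _ with walk-++ (proj₂ (to-a x∈)) a-to-y
    ...   | _ , x-to-y , _ = _ , x-to-y

    extends : ∀ {x y} → x ∈ As → y ∈ As → Edge T x y → Edge D x y
    extends {x} {y} x∈ y∈ e with ℓ ≟ x | ℓ ≟ y
    ... | yes refl | _        = subst (Edge D ℓ) (≡.sym (pendant _ y∈ e)) ℓa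
    ... | no _     | yes refl = Edge-sym D (subst (Edge D ℓ) (≡.sym (pendant _ x∈ (Edge-sym T e))) ℓa)
    ... | no ℓ≢x   | no ℓ≢y   = addEdge-⊇ D′ ℓ≢a (extends′ (rest x∈ ℓ≢x) (rest y∈ ℓ≢y) e)

    orients : ∀ {x y} → x ∈ As → y ∈ As → Edge T x y → parent x ≡ y ⊎ parent y ≡ x
    orients {x} {y} x∈ y∈ e with ℓ ≟ x | ℓ ≟ y
    ... | yes refl | _        = inj₁ (≡.sym (pendant _ y∈ e))
    ... | no _     | yes refl = inj₂ (≡.sym (pendant _ x∈ (Edge-sym T e)))
    ... | no ℓ≢x   | no ℓ≢y   = orients′ (rest x∈ ℓ≢x) (rest y∈ ℓ≢y) e

    parent-edge : ∀ t → parent t ≡ t ⊎ Edge D t (parent t)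
    parent-edge t with ℓ ≟ t
    ... | yes refl = inj₂ ℓa
    ... | no _     = Sum.map id (addEdge-⊇ D′ ℓ≢a) (parent-edge′ t)

orientedSpanningTree : (T : SimpleGraph n) → IsForest T → ∀ s {As} →
                       length As ≤ s → Unique As → x ∈ As → OrientedSpanningTree T As
orientedSpanningTree T _ _ {x ∷ []} _ _ _ = singletonSpanningTree T x
orientedSpanningTree T forest (suc s) {As@(_ ∷ _ ∷ _)} (s≤s len) uniq@(x≢ ∷ _) _ =
  attachLeaf L
    (orientedSpanningTree T forest s shorter (Unique-∖ uniq) (∈-∖⁺ neighbour∈ neighbour≢leaf))
  where
  L : LeafIn T As
  L = leafIn forest (here refl) (there (here refl)) (All.lookup x≢ (here refl))
  open LeafIn L
  shorter : length (As ∖ leaf) ≤ s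
  shorter = ≤-trans (≤-pred (length-∖ leaf∈)) len

walk? : (H : SimpleGraph n) → ∀ u w vs → Dec (Walk H u w vs)
walk? H u w [] = no λ ()
walk? H u w (x ∷ []) with x ≟ u | w ≟ u
... | yes refl | yes refl = yes here
... | no x≢u   | _        = no λ { here → x≢u refl ; (step _ ()) }
... | yes refl | no w≢u   = no λ { here → w≢u refl ; (step _ ()) }
walk? H u w (x ∷ y ∷ vs) with x ≟ u | edge? H u y | walk? H y w (y ∷ vs)
... | yes refl | yes e  | yes p  = yes (step e p)
... | no x≢u   | _      | _      = no λ { (step _ _) → x≢u refl }
... | yes refl | no ¬e  | _      = no λ { (step e p) → ¬e (subst (Edge H u) (walk-head≡ p) e) }
... | yes refl | yes _  | no ¬p  =
  no λ { (step _ p) → ¬p (subst (λ z → Walk H z w (y ∷ vs)) (walk-head≡ p) p) }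

∃-length≤? : ∀ (L : ℕ) {P : List (Fin n) → Set} → (∀ vs → Dec (P vs)) →
             Dec (∃ λ vs → length vs ≤ L × P vs)
∃-length≤? L P? with P? []
... | yes p = yes ([] , z≤n , p)
∃-length≤? zero    P? | no ¬p = no λ { ([] , _ , p) → ¬p p ; (_ ∷ _ , () , _) }
∃-length≤? (suc L) P? | no ¬p with Fin.any? (λ x → ∃-length≤? L (λ vs → P? (x ∷ vs)))
... | yes (x , vs , len , p) = yes (x ∷ vs , s≤s len , p)
... | no ¬ext = no λ { ([] , _ , p) → ¬p p ; (x ∷ vs , s≤s len , p) → ¬ext (x , vs , len , p) }

onTreePath? : (T : SimpleGraph n) → ∀ u w v → Dec (OnTreePath T u w v)
onTreePath? {n} T u w v
  with ∃-length≤? n (λ vs → (walk? T u w vs ×-dec Unique.unique? _≟_ vs) ×-dec v ∈? vs)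
... | yes (vs , _ , p∈) = yes (vs , p∈)
... | no ¬p∈ = no λ { (vs , p , v∈) → ¬p∈ (vs , Unique⇒length≤n (proj₂ p) , p , v∈) }

inLocalFeedback? : (G T : SimpleGraph n) → ∀ v e → Dec (InLocalFeedback G T v e)
inLocalFeedback? G T v (u , w) =
  u Fin.<? w ×-dec edge? G u w ×-dec ¬? (edge? T u w) ×-dec onTreePath? T u w v

elements : Subset n → List (Fin n)
elements []            = []
elements (inside ∷ p)  = zero ∷ map suc (elements p)
elements (outside ∷ p) = map suc (elements p)

length-elements : (p : Subset n) → length (elements p) ≡ ∣ p ∣
length-elements []            = refl
length-elements (inside ∷ p)  = cong suc (≡.trans (length-map suc (elements p)) (length-elements p))
length-elements (outside ∷ p) = ≡.trans (length-map suc (elements p)) (length-elements p)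

∈-elements⁺ : {p : Subset n} → x S.∈ p → x ∈ elements p
∈-elements⁺ {p = inside ∷ _}  Vec.here       = here refl
∈-elements⁺ {p = inside ∷ _}  (Vec.there x∈) = there (∈-map⁺ suc (∈-elements⁺ x∈))
∈-elements⁺ {p = outside ∷ _} (Vec.there x∈) = ∈-map⁺ suc (∈-elements⁺ x∈)

∈-elements⁻ : (p : Subset n) → x ∈ elements p → x S.∈ p
∈-elements⁻ (inside ∷ p) (here refl) = Vec.here
∈-elements⁻ (inside ∷ p) (there x∈) with ∈-map⁻ suc x∈
... | _ , y∈ , refl = Vec.there (∈-elements⁻ p y∈)
∈-elements⁻ (outside ∷ p) x∈ with ∈-map⁻ suc x∈
... | _ , y∈ , refl = Vec.there (∈-elements⁻ p y∈)

Unique-elements : (p : Subset n) → Unique (elements p)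
Unique-elements []            = []
Unique-elements (inside ∷ p)  = Unique-∷ zero∉ (map⁺ Fin.suc-injective (Unique-elements p))
  where
  zero∉ : zero ∉ map suc (elements p)
  zero∉ z∈ with ∈-map⁻ suc z∈
  ... | _ , _ , ()
Unique-elements (outside ∷ p) = map⁺ Fin.suc-injective (Unique-elements p)

∣p∣≤length : (p : Subset n) → (∀ {x} → x S.∈ p → x ∈ vs) → ∣ p ∣ ≤ length vs
∣p∣≤length p p⊆vs =
  subst (_≤ _) (length-elements p) (Unique-⊆⇒length≤ (Unique-elements p) (p⊆vs ∘ ∈-elements⁻ p))

subsetOf : {P : Fin n → Set} → (∀ x → Dec (P x)) → Subset n
subsetOf P? = Vec.tabulate (λ x → ⌊ P? x ⌋)

module _ {P : Fin n → Set} (P? : ∀ x → Dec (P x)) where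

  ∈-subsetOf⁺ : P x → x S.∈ subsetOf P?
  ∈-subsetOf⁺ {x} px =
    lookup⇒[]= x _ (≡.trans (lookup∘tabulate _ x) (Equivalence.to T-≡ (fromWitness px)))

  ∈-subsetOf⁻ : x S.∈ subsetOf P? → P x
  ∈-subsetOf⁻ {x} x∈ =
    toWitness (Equivalence.from T-≡ (≡.trans (≡.sym (lookup∘tabulate _ x)) ([]=⇒lookup x∈)))

-- The decomposition

maxSpanningForest-path : IsMaxSpanningForest H T → Edge H u w → OnTreePath T u w w
maxSpanningForest-path (_ , _ , connects) e with walk⇒path (proj₂ (connects _ _ e))
... | _ , path , _ = _ , path , walk-last∈ (proj₁ path)

module _ (G : SimpleGraph n) {T : SimpleGraph n} (S : OrientedSpanningTree T (allFin n)) where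
  open OrientedSpanningTree S

  LowerEnd : Fin n → Fin n → Set
  LowerEnd v x = ∃ λ w → InLocalFeedback G T v (x , w)

  lowerEnd? : ∀ v x → Dec (LowerEnd v x)
  lowerEnd? v x = Fin.any? (λ w → inLocalFeedback? G T v (x , w))

  lowerEnds : Fin n → Subset n
  lowerEnds v = subsetOf (lowerEnd? v)

  InBag : Fin n → Fin n → Set
  InBag v x = x ≡ v ⊎ x ≡ parent v ⊎ LowerEnd v x

  inBag? : ∀ v x → Dec (InBag v x)
  inBag? v x = x ≟ v ⊎-dec x ≟ parent v ⊎-dec lowerEnd? v x

  bagAt : Fin n → Subset n
  bagAt v = subsetOf (inBag? v)

  ∈-bagAt⁺ : ∀ {v x} → InBag v x → x S.∈ bagAt v
  ∈-bagAt⁺ {v} = ∈-subsetOf⁺ (inBag? v)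

  ∈-bagAt⁻ : ∀ {v x} → x S.∈ bagAt v → InBag v x
  ∈-bagAt⁻ {v} = ∈-subsetOf⁻ (inBag? v)

  partner : Fin n → Fin n → Fin n
  partner v x with lowerEnd? v x
  ... | yes (w , _) = w
  ... | no _        = x

  partner-feedback : ∀ {v x} → LowerEnd v x → InLocalFeedback G T v (x , partner v x)
  partner-feedback {v} {x} (w , fb) with lowerEnd? v x
  ... | yes (_ , fb′) = fb′
  ... | no ¬lower     = ⊥-elim (¬lower (w , fb))

  ∣lowerEnds∣≤ : ∀ {v k} → LocalFeedbackAtMost G T v k → ∣ lowerEnds v ∣ ≤ k
  ∣lowerEnds∣≤ {v} {k} feedback≤k =
    subst (_≤ k) (≡.trans (length-map pair xs) (length-elements (lowerEnds v)))
      (feedback≤k (map pair xs) (map⁺ (cong proj₁) (Unique-elements (lowerEnds v)))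
                  (All.tabulate λ e∈ → feedback (∈-map⁻ pair e∈)))
    where
    xs : List (Fin n)
    xs = elements (lowerEnds v)
    pair : Fin n → Fin n × Fin n
    pair x = x , partner v x
    feedback : ∀ {e} → ∃ (λ x → x ∈ xs × e ≡ pair x) → InLocalFeedback G T v e
    feedback (x , x∈ , refl) =
      partner-feedback (∈-subsetOf⁻ (lowerEnd? v) (∈-elements⁻ (lowerEnds v) x∈))

  bag-width : ∀ {k} → EcwAtMostSuc G T k → ∀ v → ∣ bagAt v ∣ ≤ suc (suc k)
  bag-width ecw v = ≤-trans (∣p∣≤length (bagAt v) (covered ∘ ∈-bagAt⁻))
                            (s≤s (s≤s (≤-trans (≤-reflexive (length-elements (lowerEnds v)))
                                               (∣lowerEnds∣≤ (ecw v)))))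
    where
    covered : ∀ {x} → InBag v x → x ∈ v ∷ parent v ∷ elements (lowerEnds v)
    covered (inj₁ refl)         = here refl
    covered (inj₂ (inj₁ refl))  = there (here refl)
    covered (inj₂ (inj₂ lower)) = there (there (∈-elements⁺ (∈-subsetOf⁺ (lowerEnd? v) lower)))

  module _ (msf : IsMaxSpanningForest G T) where

    lower-end-in-bag : ∀ {u w} → toℕ u < toℕ w → Edge G u w → ¬ Edge T u w → u S.∈ bagAt w
    lower-end-in-bag u<w eG ¬eT =
      ∈-bagAt⁺ (inj₂ (inj₂ (_ , u<w , eG , ¬eT , maxSpanningForest-path {H = G} msf eG)))

    edge-in-bag : ∀ u w → Edge G u w → ∃ λ t → u S.∈ bagAt t × w S.∈ bagAt t
    edge-in-bag u w e with edge? T u w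
    ... | yes eT with orients (∈-allFin u) (∈-allFin w) eT
    ...   | inj₁ refl = u , ∈-bagAt⁺ (inj₁ refl) , ∈-bagAt⁺ (inj₂ (inj₁ refl))
    ...   | inj₂ refl = w , ∈-bagAt⁺ (inj₂ (inj₁ refl)) , ∈-bagAt⁺ (inj₁ refl)
    edge-in-bag u w e | no ¬eT with Fin.<-cmp u w
    ... | tri< u<w _ _  = w , lower-end-in-bag u<w e ¬eT , ∈-bagAt⁺ (inj₁ refl)
    ... | tri≈ _ refl _ = ⊥-elim (Edge-irrefl G e)
    ... | tri> _ _ w<u  =
      u , ∈-bagAt⁺ (inj₁ refl) , lower-end-in-bag w<u (Edge-sym G e) (¬eT ∘ Edge-sym T)

  BagsContain : Fin n → List (Fin n) → Set
  BagsContain x ts = All (λ t → x S.∈ bagAt t) ts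

  walk-to-bag : ∀ {x t} → x S.∈ bagAt t → ∃ λ ts → Walk graph x t ts × BagsContain x ts
  walk-to-bag x∈ with ∈-bagAt⁻ x∈
  ... | inj₁ refl = _ , here , ∈-bagAt⁺ (inj₁ refl) ∷ []
  walk-to-bag {t = t} x∈ | inj₂ (inj₁ refl) with parent-edge t
  ... | inj₁ root =
    _ , subst (λ z → Walk graph (parent t) z (parent t ∷ [])) root here , ∈-bagAt⁺ (inj₁ refl) ∷ []
  ... | inj₂ e    = _ , step (Edge-sym graph e) here , ∈-bagAt⁺ (inj₁ refl) ∷ x∈ ∷ []
  walk-to-bag x∈ | inj₂ (inj₂ (w , u<w , eG , ¬eT , vs , path , t∈vs)) with path-prefix path t∈vs
  ... | pre , (p , _) , pre⊆vs =
    pre , walk-map (λ _ _ → extends (∈-allFin _) (∈-allFin _)) p ,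
    All.tabulate λ s∈ → ∈-bagAt⁺ (inj₂ (inj₂ (w , u<w , eG , ¬eT , vs , path , pre⊆vs s∈)))

  bags-coherent : ∀ x t₁ t₂ → x S.∈ bagAt t₁ → x S.∈ bagAt t₂ →
                  ∃ λ ts → Walk graph t₁ t₂ ts × BagsContain x ts
  bags-coherent x t₁ t₂ x∈₁ x∈₂ with walk-to-bag x∈₁ | walk-to-bag x∈₂
  ... | _ , p₁ , all₁ | _ , p₂ , all₂ with walk-reverse p₁
  ... | _ , r₁ , r₁⊆ with walk-++ r₁ p₂
  ... | _ , q , q⊆ =
    _ , q , All.tabulate λ s∈ → [ All.lookup all₁ ∘ r₁⊆ , All.lookup all₂ ] (q⊆ s∈)

  spanningDecomposition : IsMaxSpanningForest G T → 1 ≤ n → TreeDecomposition G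
  spanningDecomposition msf 1≤n = record
    { m         = n
    ; tree      = graph
    ; isTree    = 1≤n , (λ u w → connected (∈-allFin u) (∈-allFin w)) , acyclic
    ; bag       = bagAt
    ; covers    = λ v → v , ∈-bagAt⁺ (inj₁ refl)
    ; edgeCover = edge-in-bag msf
    ; coherent  = bags-coherent
    }

emptyDecomposition : (G : SimpleGraph 0) → TreeDecomposition G
emptyDecomposition G = record
  { m         = 1
  ; tree      = emptyGraph 1
  ; isTree    = s≤s z≤n , (λ { zero zero → _ , here }) , (λ { (_ , _ , _ , _ , _ , ()) })
  ; bag       = λ _ → []
  ; covers    = λ ()
  ; edgeCover = λ ()
  ; coherent  = λ ()
  }

lemma3 : ∀ {n} (G T : SimpleGraph n) (k : ℕ) →
         IsMaxSpanningForest G T → EcwAtMostSuc G T k →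
         TreewidthAtMost G (suc k)
lemma3 {zero}  G T k _ _ = emptyDecomposition G , λ _ → z≤n
lemma3 {suc n} G T k msf ecw = spanningDecomposition G S msf (s≤s z≤n) , bag-width G S ecw
  where
  S : OrientedSpanningTree T (allFin (suc n))
  S = orientedSpanningTree T (proj₁ (proj₂ msf)) _ ≤-refl (allFin⁺ (suc n)) (∈-allFin zero)
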